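{- The sequence $(x_n^{(3)})$ satisfies $x_1^{(3)}=3$, $x_2^{(3)}=6$, and $x_{2n-1}^{(3)}=2x_{n-1}^{(3)}+1$ for all $n\geq2$, $x_{2n}^{(3)}=2x_n^{(3)}$ for all $n\geq1$.
   Context: For a positive integer $m$, let $\nu_2(m)$ be the exponent of the highest power of $2$ dividing $m$. Define $x_1^{(3)}=3$ and, for $n\ge2$, $x_n^{(3)}$ is the smallest integer $y>x_{n-1}^{(3)}$ with $\nu_2(y)=\nu_2(n)$. -}

module Defs where

open import Data.Nat using (ℕ; zero; suc; _+_; _*_; _^_; _≡ᵇ_; _<_; _≤_)
open import Data.Nat.Divisibility using (_∣?_)
open import Data.Bool using (Bool; true; false; if_then_else_)
open import Relation.Nullary.Decidable using (does)

-- 2-adic valuation ν₂ m (the paper only uses it for m ≥ 1).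
-- Fuel-based: ν₂-aux f m = largest k ≤ f with 2^k ∣ m, computed by repeated
-- halving; with fuel m this is exactly ν₂(m) for m ≥ 1 (since ν₂ m < m).
ν₂-aux : ℕ → ℕ → ℕ
ν₂-aux zero    m = zero
ν₂-aux (suc f) m = if does (2 ∣? m) then suc (ν₂-aux f (halve m)) else zero
  where
  halve : ℕ → ℕ
  halve zero = zero
  halve (suc zero) = zero
  halve (suc (suc k)) = suc (halve k)

ν₂ : ℕ → ℕ
ν₂ m = ν₂-aux m m

-- first y in {p+1, p+2, …, p+f} with ν₂ y = k (returns p+f+1 if none,
-- which never happens with the fuel used below).
search : ℕ → ℕ → ℕ → ℕ
search zero    p k = suc p
search (suc f) p k = if ν₂ (suc p) ≡ᵇ k then suc p else search f (suc p) k

-- smallest y > p with ν₂ y = k.  Among any 2^(k+1) consecutive integers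
-- there is one with ν₂ = k, so fuel 2^(k+1) suffices.
next : ℕ → ℕ → ℕ
next p k = search (2 ^ suc k) p k

-- x n = x_n^{(3)} for n ≥ 1 (the value at index 0 is a dummy, unused).
x : ℕ → ℕ
x zero = 0
x (suc zero) = 3
x (suc (suc n)) = next (x (suc n)) (ν₂ (suc (suc n)))

{-# OPTIONS --safe #-}
-- On the dyadic block 2^t ≤ n < 2^(t+1), say n = 2^t + j, one has
-- x n = 3·2^t + j.  Inside a block x grows by one at each step, because adding
-- a multiple of 2^t does not change the 2-adic valuation of a number in
-- [1, 2^t); at the start of the next block the search skips over the numbers
-- 4·2^t + i, whose valuations are t+2 or ν₂ i < t+1, and lands on 6·2^t.
-- Doubling n (and doubling plus one) maps block t to block t+1, where both
-- recursions become identities between the closed forms.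
module Submission where

open import Defs
open import Data.Nat
  using (ℕ; zero; suc; pred; _*_; _+_; _∸_; _≤_; _<_; _^_; _≡ᵇ_; ⌊_/2⌋; z≤n; z<s; s≤s; s≤s⁻¹)
open import Data.Product using (_×_; _,_; ∃-syntax)
open import Relation.Binary.PropositionalEquality
  using (_≡_; _≢_; refl; sym; trans; cong; cong₂; subst; module ≡-Reasoning)

open import Data.Bool.Base using (true; false; if_then_else_)
open import Data.Empty using (⊥-elim)
open import Data.Nat.Divisibility using (_∣_; divides; _∣?_; m∣m*n)
open import Data.Nat.Properties
open import Data.Nat.Tactic.RingSolver using (solve-∀)
open import Data.Sum.Base using (inj₁; inj₂)
open import Function.Base using (_∘_)
open import Relation.Nullary using (¬_)
open import Relation.Nullary.Decidable using (does; dec-true; dec-false)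

data EvenOrOdd : ℕ → Set where
  even : ∀ k → EvenOrOdd (2 * k)
  odd  : ∀ k → EvenOrOdd (suc (2 * k))

evenOrOdd : ∀ n → EvenOrOdd n
evenOrOdd zero = even 0
evenOrOdd (suc n) with evenOrOdd n
... | even k = odd k
... | odd k  = subst EvenOrOdd (*-suc 2 k) (even (suc k))

⌊2*n/2⌋≡n : ∀ n → ⌊ 2 * n /2⌋ ≡ n
⌊2*n/2⌋≡n n = sym (trans (n≡⌊n+n/2⌋ n) (cong (λ m → ⌊ n + m /2⌋) (sym (+-identityʳ n))))

2∤1+2k : ∀ k → ¬ 2 ∣ suc (2 * k)
2∤1+2k k (divides q eq) = even≢odd q k (trans (*-comm 2 q) (sym eq))

-- The halving function local to ν₂-aux has no name outside Defs, so its
-- agreement with ⌊_/2⌋ is stated with that name left to unification;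
-- abstracting the argument with 'with' turns the problem into a pattern.
mutual
  ν₂-aux-suc : ∀ f m →
    ν₂-aux (suc f) m ≡ (if does (2 ∣? m) then suc (ν₂-aux f ⌊ m /2⌋) else zero)
  ν₂-aux-suc f zero          = refl
  ν₂-aux-suc f (suc zero)    = refl
  ν₂-aux-suc f (suc (suc k)) with suc (suc k)
  ... | m = cong (λ h → if _ then suc (ν₂-aux f (suc h)) else zero) (halve≡⌊/2⌋ f m k)

  halve≡⌊/2⌋ : ∀ f m k → _ ≡ ⌊ k /2⌋
  halve≡⌊/2⌋ f m zero          = refl
  halve≡⌊/2⌋ f m (suc zero)    = refl
  halve≡⌊/2⌋ f m (suc (suc k)) = cong suc (halve≡⌊/2⌋ f m k)

ν₂-aux-even : ∀ f k → ν₂-aux (suc f) (2 * k) ≡ suc (ν₂-aux f k)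
ν₂-aux-even f k = begin
  ν₂-aux (suc f) (2 * k)
    ≡⟨ ν₂-aux-suc f (2 * k) ⟩
  (if does (2 ∣? 2 * k) then suc (ν₂-aux f ⌊ 2 * k /2⌋) else zero)
    ≡⟨ cong (λ b → if b then suc (ν₂-aux f ⌊ 2 * k /2⌋) else zero) (dec-true (2 ∣? 2 * k) (m∣m*n k)) ⟩
  suc (ν₂-aux f ⌊ 2 * k /2⌋)
    ≡⟨ cong (suc ∘ ν₂-aux f) (⌊2*n/2⌋≡n k) ⟩
  suc (ν₂-aux f k) ∎
  where open ≡-Reasoning

ν₂-aux-odd : ∀ f k → ν₂-aux (suc f) (suc (2 * k)) ≡ 0
ν₂-aux-odd f k = trans (ν₂-aux-suc f (suc (2 * k)))
  (cong (λ b → if b then suc (ν₂-aux f ⌊ suc (2 * k) /2⌋) else zero) (dec-false (2 ∣? suc (2 * k)) (2∤1+2k k)))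

2*[1+k]≤1+n⇒1+k≤n : ∀ {k n} → 2 * suc k ≤ suc n → suc k ≤ n
2*[1+k]≤1+n⇒1+k≤n {k} le =
  ≤-trans (s≤s (m≤m+n k (k + 0))) (≤-trans (≤-reflexive (sym (+-suc k (k + 0)))) (s≤s⁻¹ le))

ν₂-aux-fuel : ∀ {f g m} → 0 < m → m ≤ f → m ≤ g → ν₂-aux f m ≡ ν₂-aux g m
ν₂-aux-fuel {zero}          0<m m≤0 _   = ⊥-elim (<⇒≱ 0<m m≤0)
ν₂-aux-fuel {suc f} {zero}  0<m _   m≤0 = ⊥-elim (<⇒≱ 0<m m≤0)
ν₂-aux-fuel {suc f} {suc g} {m} 0<m m≤f m≤g with evenOrOdd m
... | odd k        = trans (ν₂-aux-odd f k) (sym (ν₂-aux-odd g k))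
... | even zero    = ⊥-elim (n≮0 0<m)
... | even (suc k) = begin
  ν₂-aux (suc f) (2 * suc k)  ≡⟨ ν₂-aux-even f (suc k) ⟩
  suc (ν₂-aux f (suc k))      ≡⟨ cong suc (ν₂-aux-fuel z<s (2*[1+k]≤1+n⇒1+k≤n m≤f) (2*[1+k]≤1+n⇒1+k≤n m≤g)) ⟩
  suc (ν₂-aux g (suc k))      ≡⟨ ν₂-aux-even g (suc k) ⟨
  ν₂-aux (suc g) (2 * suc k)  ∎
  where open ≡-Reasoning

ν₂[1+2k]≡0 : ∀ k → ν₂ (suc (2 * k)) ≡ 0
ν₂[1+2k]≡0 k = ν₂-aux-odd (2 * k) k

ν₂[2*m]≡1+ν₂m : ∀ m → 0 < m → ν₂ (2 * m) ≡ suc (ν₂ m)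
ν₂[2*m]≡1+ν₂m (suc k) _ =
  trans (ν₂-aux-even (pred (2 * suc k)) (suc k))
        (cong suc (ν₂-aux-fuel z<s (2*[1+k]≤1+n⇒1+k≤n {k} ≤-refl) ≤-refl))

ν₂[2^k*odd]≡k : ∀ k m → ν₂ (2 ^ k * suc (2 * m)) ≡ k
ν₂[2^k*odd]≡k zero    m = trans (cong ν₂ (*-identityˡ (suc (2 * m)))) (ν₂[1+2k]≡0 m)
ν₂[2^k*odd]≡k (suc k) m = begin
  ν₂ (2 * 2 ^ k * o)    ≡⟨ cong ν₂ (*-assoc 2 (2 ^ k) o) ⟩
  ν₂ (2 * (2 ^ k * o))  ≡⟨ ν₂[2*m]≡1+ν₂m (2 ^ k * o) (≤-trans (m^n>0 2 k) (m≤m*n (2 ^ k) o)) ⟩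
  suc (ν₂ (2 ^ k * o))  ≡⟨ cong suc (ν₂[2^k*odd]≡k k m) ⟩
  suc k                 ∎
  where
  open ≡-Reasoning
  o : ℕ
  o = suc (2 * m)

ν₂[2^k]≡k : ∀ k → ν₂ (2 ^ k) ≡ k
ν₂[2^k]≡k k = trans (cong ν₂ (sym (*-identityʳ (2 ^ k)))) (ν₂[2^k*odd]≡k k 0)

0<r<2^t⇒ν₂r<t : ∀ t r → 0 < r → r < 2 ^ t → ν₂ r < t
0<r<2^t⇒ν₂r<t zero    r 0<r r<1 = ⊥-elim (<⇒≱ r<1 0<r)
0<r<2^t⇒ν₂r<t (suc t) r 0<r r<2^t with evenOrOdd r
... | odd k        = subst (_< suc t) (sym (ν₂[1+2k]≡0 k)) z<s
... | even zero    = ⊥-elim (n≮0 0<r)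
... | even (suc k) = subst (_< suc t) (sym (ν₂[2*m]≡1+ν₂m (suc k) z<s))
  (s≤s (0<r<2^t⇒ν₂r<t t (suc k) z<s (*-cancelˡ-< 2 (suc k) (2 ^ t) r<2^t)))

ν₂[a*2^t+r]≡ν₂r : ∀ t a r → 0 < r → r < 2 ^ t → ν₂ (a * 2 ^ t + r) ≡ ν₂ r
ν₂[a*2^t+r]≡ν₂r zero    a r 0<r r<1 = ⊥-elim (<⇒≱ r<1 0<r)
ν₂[a*2^t+r]≡ν₂r (suc t) a r 0<r r<2^t with evenOrOdd r
... | odd k        = begin
  ν₂ (a * 2 ^ suc t + suc (2 * k))   ≡⟨ cong ν₂ (odd-shift a (2 ^ t) k) ⟩
  ν₂ (suc (2 * (a * 2 ^ t + k)))     ≡⟨ ν₂[1+2k]≡0 (a * 2 ^ t + k) ⟩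
  0                                  ≡⟨ ν₂[1+2k]≡0 k ⟨
  ν₂ (suc (2 * k))                   ∎
  where
  open ≡-Reasoning
  odd-shift : ∀ a P k → a * (2 * P) + suc (2 * k) ≡ suc (2 * (a * P + k))
  odd-shift = solve-∀
... | even zero    = ⊥-elim (n≮0 0<r)
... | even (suc k) = begin
  ν₂ (a * 2 ^ suc t + 2 * suc k)     ≡⟨ cong ν₂ (even-shift a (2 ^ t) (suc k)) ⟩
  ν₂ (2 * (a * 2 ^ t + suc k))       ≡⟨ ν₂[2*m]≡1+ν₂m (a * 2 ^ t + suc k) (<-≤-trans z<s (m≤n+m (suc k) (a * 2 ^ t))) ⟩
  suc (ν₂ (a * 2 ^ t + suc k))       ≡⟨ cong suc (ν₂[a*2^t+r]≡ν₂r t a (suc k) z<s (*-cancelˡ-< 2 (suc k) (2 ^ t) r<2^t)) ⟩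
  suc (ν₂ (suc k))                   ≡⟨ ν₂[2*m]≡1+ν₂m (suc k) z<s ⟨
  ν₂ (2 * suc k)                     ∎
  where
  open ≡-Reasoning
  even-shift : ∀ a P k → a * (2 * P) + 2 * k ≡ 2 * (a * P + k)
  even-shift = solve-∀

ν₂[2^t+r]≡ν₂r : ∀ t r → 0 < r → r < 2 ^ t → ν₂ (2 ^ t + r) ≡ ν₂ r
ν₂[2^t+r]≡ν₂r t r 0<r r<2^t =
  trans (cong (λ q → ν₂ (q + r)) (sym (*-identityˡ (2 ^ t)))) (ν₂[a*2^t+r]≡ν₂r t 1 r 0<r r<2^t)

search-hit : ∀ f p k → ν₂ (suc p) ≡ k → search (suc f) p k ≡ suc p
search-hit f p k hit with ν₂ (suc p) ≡ᵇ k | ≡⇒≡ᵇ (ν₂ (suc p)) k hit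
... | true | _ = refl

search-miss : ∀ f p k → ν₂ (suc p) ≢ k → search (suc f) p k ≡ search f (suc p) k
search-miss f p k miss with ν₂ (suc p) ≡ᵇ k | ≡ᵇ⇒≡ (ν₂ (suc p)) k
... | true  | sound = ⊥-elim (miss (sound _))
... | false | _     = refl

search-skip : ∀ d f p k → (∀ i → i < d → ν₂ (suc (p + i)) ≢ k) →
              search (d + f) p k ≡ search f (p + d) k
search-skip zero    f p k _     = cong (λ q → search f q k) (sym (+-identityʳ p))
search-skip (suc d) f p k misses = begin
  search (suc (d + f)) p k   ≡⟨ search-miss (d + f) p k (subst (λ q → ν₂ (suc q) ≢ k) (+-identityʳ p) (misses 0 z<s)) ⟩
  search (d + f) (suc p) k   ≡⟨ search-skip d f (suc p) k (λ i i<d → subst (λ q → ν₂ (suc q) ≢ k) (+-suc p i) (misses (suc i) (s≤s i<d))) ⟩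
  search f (suc p + d) k     ≡⟨ cong (λ q → search f q k) (+-suc p d) ⟨
  search f (p + suc d) k     ∎
  where open ≡-Reasoning

next-first-hit : ∀ p k d → (∀ i → i < d → ν₂ (suc (p + i)) ≢ k) →
                 ν₂ (suc (p + d)) ≡ k → d < 2 ^ suc k → next p k ≡ suc (p + d)
next-first-hit p k d misses hit d<fuel = begin
  search (2 ^ suc k) p k     ≡⟨ cong (λ f → search f p k) fuel-split ⟨
  search (d + suc f) p k     ≡⟨ search-skip d (suc f) p k misses ⟩
  search (suc f) (p + d) k   ≡⟨ search-hit f (p + d) k hit ⟩
  suc (p + d)                ∎
  where
  open ≡-Reasoning
  f : ℕ
  f = 2 ^ suc k ∸ suc d
  fuel-split : d + suc f ≡ 2 ^ suc k
  fuel-split = trans (+-suc d f) (m+[n∸m]≡n d<fuel)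

next-hit : ∀ p k → ν₂ (suc p) ≡ k → next p k ≡ suc p
next-hit p k hit = begin
  next p k         ≡⟨ next-first-hit p k 0 (λ _ ()) hit′ (m^n>0 2 (suc k)) ⟩
  suc (p + 0)      ≡⟨ cong suc (+-identityʳ p) ⟩
  suc p            ∎
  where
  open ≡-Reasoning
  hit′ : ν₂ (suc (p + 0)) ≡ k
  hit′ = subst (λ q → ν₂ (suc q) ≡ k) (sym (+-identityʳ p)) hit

x-suc : ∀ n → 0 < n → x (suc n) ≡ next (x n) (ν₂ (suc n))
x-suc (suc n) _ = refl

x-block-step : ∀ t j → suc j < 2 ^ t → x (2 ^ t + j) ≡ 3 * 2 ^ t + j →
               x (2 ^ t + suc j) ≡ 3 * 2 ^ t + suc j
x-block-step t j 1+j<2^t xj = begin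
  x (2 ^ t + suc j)                          ≡⟨ cong x (+-suc (2 ^ t) j) ⟩
  x (suc (2 ^ t + j))                        ≡⟨ x-suc (2 ^ t + j) (<-≤-trans (m^n>0 2 t) (m≤m+n (2 ^ t) j)) ⟩
  next (x (2 ^ t + j)) (ν₂ (suc (2 ^ t + j))) ≡⟨ cong₂ next xj valuation ⟩
  next (3 * 2 ^ t + j) (ν₂ (suc j))          ≡⟨ next-hit (3 * 2 ^ t + j) (ν₂ (suc j)) hit ⟩
  suc (3 * 2 ^ t + j)                        ≡⟨ +-suc (3 * 2 ^ t) j ⟨
  3 * 2 ^ t + suc j                          ∎
  where
  open ≡-Reasoning
  valuation : ν₂ (suc (2 ^ t + j)) ≡ ν₂ (suc j)
  valuation = trans (cong ν₂ (sym (+-suc (2 ^ t) j))) (ν₂[2^t+r]≡ν₂r t (suc j) z<s 1+j<2^t)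
  hit : ν₂ (suc (3 * 2 ^ t + j)) ≡ ν₂ (suc j)
  hit = trans (cong ν₂ (sym (+-suc (3 * 2 ^ t) j))) (ν₂[a*2^t+r]≡ν₂r t 3 (suc j) z<s 1+j<2^t)

x-block-start : ∀ t j → suc j ≡ 2 ^ t → x (2 ^ t + j) ≡ 3 * 2 ^ t + j →
                x (2 ^ suc t) ≡ 3 * 2 ^ suc t
x-block-start t j 1+j≡2^t xj = begin
  x (2 ^ suc t)                                ≡⟨ cong x index ⟨
  x (suc (2 ^ t + j))                          ≡⟨ x-suc (2 ^ t + j) (<-≤-trans (m^n>0 2 t) (m≤m+n (2 ^ t) j)) ⟩
  next (x (2 ^ t + j)) (ν₂ (suc (2 ^ t + j)))  ≡⟨ cong₂ next xj (trans (cong ν₂ index) (ν₂[2^k]≡k (suc t))) ⟩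
  next (3 * 2 ^ t + j) (suc t)                 ≡⟨ next-first-hit _ _ (2 ^ suc t) misses hit 2^[1+t]<2^[2+t] ⟩
  suc (3 * 2 ^ t + j + 2 ^ suc t)              ≡⟨ shifted (2 ^ suc t) ⟩
  2 ^ suc (suc t) + 2 ^ suc t                  ≡⟨ 4P+2P≡3*2P (2 ^ t) ⟩
  3 * 2 ^ suc t                                ∎
  where
  open ≡-Reasoning
  4P+2P≡3*2P : ∀ P → 2 * (2 * P) + 2 * P ≡ 3 * (2 * P)
  4P+2P≡3*2P = solve-∀
  2^[1+t]<2^[2+t] : 2 ^ suc t < 2 ^ suc (suc t)
  2^[1+t]<2^[2+t] = ^-monoʳ-< 2 (s≤s (s≤s z≤n)) (n<1+n (suc t))
  index : suc (2 ^ t + j) ≡ 2 ^ suc t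
  index = trans (sym (+-suc (2 ^ t) j)) (cong (2 ^ t +_) (trans 1+j≡2^t (sym (+-identityʳ (2 ^ t)))))
  shifted : ∀ i → suc (3 * 2 ^ t + j + i) ≡ 2 ^ suc (suc t) + i
  shifted i = begin
    suc (3 * 2 ^ t + j + i)  ≡⟨ suc-inward (2 ^ t) j i ⟩
    3 * 2 ^ t + suc j + i    ≡⟨ cong (λ s → 3 * 2 ^ t + s + i) 1+j≡2^t ⟩
    3 * 2 ^ t + 2 ^ t + i    ≡⟨ 3P+P≡4P (2 ^ t) i ⟩
    2 ^ suc (suc t) + i      ∎
    where
    suc-inward : ∀ P j i → suc (3 * P + j + i) ≡ 3 * P + suc j + i
    suc-inward = solve-∀
    3P+P≡4P : ∀ P i → 3 * P + P + i ≡ 2 * (2 * P) + i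
    3P+P≡4P = solve-∀
  hit : ν₂ (suc (3 * 2 ^ t + j + 2 ^ suc t)) ≡ suc t
  hit = begin
    ν₂ (suc (3 * 2 ^ t + j + 2 ^ suc t))  ≡⟨ cong ν₂ (shifted (2 ^ suc t)) ⟩
    ν₂ (2 ^ suc (suc t) + 2 ^ suc t)      ≡⟨ cong ν₂ (4P+2P≡2P*3 (2 ^ t)) ⟩
    ν₂ (2 ^ suc t * 3)                    ≡⟨ ν₂[2^k*odd]≡k (suc t) 1 ⟩
    suc t                                 ∎
    where
    4P+2P≡2P*3 : ∀ P → 2 * (2 * P) + 2 * P ≡ 2 * P * 3
    4P+2P≡2P*3 = solve-∀
  ν₂[2^[2+t]+i]≢1+t : ∀ i → i < 2 ^ suc t → ν₂ (2 ^ suc (suc t) + i) ≢ suc t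
  ν₂[2^[2+t]+i]≢1+t zero    _ =
    subst (_≢ suc t) (trans (sym (ν₂[2^k]≡k (suc (suc t)))) (cong ν₂ (sym (+-identityʳ (2 ^ suc (suc t)))))) 1+n≢n
  ν₂[2^[2+t]+i]≢1+t (suc i) i<2^[1+t] =
    subst (_≢ suc t) (sym (ν₂[2^t+r]≡ν₂r (suc (suc t)) (suc i) z<s (<-trans i<2^[1+t] 2^[1+t]<2^[2+t])))
      (<⇒≢ (0<r<2^t⇒ν₂r<t (suc t) (suc i) z<s i<2^[1+t]))
  misses : ∀ i → i < 2 ^ suc t → ν₂ (suc (3 * 2 ^ t + j + i)) ≢ suc t
  misses i i<2^[1+t] = subst (_≢ suc t) (cong ν₂ (sym (shifted i))) (ν₂[2^[2+t]+i]≢1+t i i<2^[1+t])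

x[2^t+j]≡3*2^t+j : ∀ t j → j < 2 ^ t → x (2 ^ t + j) ≡ 3 * 2 ^ t + j
x[2^t+j]≡3*2^t+j zero    zero    _ = refl
x[2^t+j]≡3*2^t+j zero    (suc j) (s≤s ())
x[2^t+j]≡3*2^t+j (suc t) zero    _ = begin
  x (2 ^ suc t + 0)   ≡⟨ cong x (+-identityʳ (2 ^ suc t)) ⟩
  x (2 ^ suc t)       ≡⟨ x-block-start t j 1+j≡2^t (x[2^t+j]≡3*2^t+j t j (≤-reflexive 1+j≡2^t)) ⟩
  3 * 2 ^ suc t       ≡⟨ +-identityʳ (3 * 2 ^ suc t) ⟨
  3 * 2 ^ suc t + 0   ∎
  where
  open ≡-Reasoning
  j : ℕ
  j = pred (2 ^ t)
  1+j≡2^t : suc j ≡ 2 ^ t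
  1+j≡2^t = suc-pred (2 ^ t) {{m^n≢0 2 t}}
x[2^t+j]≡3*2^t+j (suc t) (suc j) 1+j<2^t =
  x-block-step (suc t) j 1+j<2^t (x[2^t+j]≡3*2^t+j (suc t) j (<-trans (n<1+n j) 1+j<2^t))

0<n⇒∃2^t+j : ∀ n → 0 < n → ∃[ t ] ∃[ j ] j < 2 ^ t × n ≡ 2 ^ t + j
0<n⇒∃2^t+j (suc zero)    _ = 0 , 0 , z<s , refl
0<n⇒∃2^t+j (suc (suc n)) _ with 0<n⇒∃2^t+j (suc n) z<s
... | t , j , j<2^t , n≡2^t+j with m≤n⇒m<n∨m≡n j<2^t
...   | inj₁ 1+j<2^t = t , suc j , 1+j<2^t , trans (cong suc n≡2^t+j) (sym (+-suc (2 ^ t) j))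
...   | inj₂ 1+j≡2^t = suc t , 0 , m^n>0 2 (suc t) , n+1≡2^[1+t]+0
  where
  open ≡-Reasoning
  n+1≡2^[1+t]+0 : suc (suc n) ≡ 2 ^ suc t + 0
  n+1≡2^[1+t]+0 = begin
    suc (suc n)          ≡⟨ cong suc n≡2^t+j ⟩
    suc (2 ^ t + j)      ≡⟨ +-suc (2 ^ t) j ⟨
    2 ^ t + suc j        ≡⟨ cong (2 ^ t +_) (trans 1+j≡2^t (sym (+-identityʳ (2 ^ t)))) ⟩
    2 ^ suc t            ≡⟨ +-identityʳ (2 ^ suc t) ⟨
    2 ^ suc t + 0        ∎

x[2n]≡2*xn : ∀ n → 0 < n → x (2 * n) ≡ 2 * x n
x[2n]≡2*xn n 0<n with 0<n⇒∃2^t+j n 0<n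
... | t , j , j<2^t , refl = begin
  x (2 * (2 ^ t + j))       ≡⟨ cong x (*-distribˡ-+ 2 (2 ^ t) j) ⟩
  x (2 ^ suc t + 2 * j)     ≡⟨ x[2^t+j]≡3*2^t+j (suc t) (2 * j) (*-monoʳ-< 2 j<2^t) ⟩
  3 * 2 ^ suc t + 2 * j     ≡⟨ double (2 ^ t) j ⟩
  2 * (3 * 2 ^ t + j)       ≡⟨ cong (2 *_) (x[2^t+j]≡3*2^t+j t j j<2^t) ⟨
  2 * x (2 ^ t + j)         ∎
  where
  open ≡-Reasoning
  double : ∀ P j → 3 * (2 * P) + 2 * j ≡ 2 * (3 * P + j)
  double = solve-∀

x[1+2n]≡1+2*xn : ∀ n → 0 < n → x (suc (2 * n)) ≡ suc (2 * x n)
x[1+2n]≡1+2*xn n 0<n with 0<n⇒∃2^t+j n 0<n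
... | t , j , j<2^t , refl = begin
  x (suc (2 * (2 ^ t + j)))      ≡⟨ cong (x ∘ suc) (*-distribˡ-+ 2 (2 ^ t) j) ⟩
  x (suc (2 ^ suc t + 2 * j))    ≡⟨ cong x (+-suc (2 ^ suc t) (2 * j)) ⟨
  x (2 ^ suc t + suc (2 * j))    ≡⟨ x[2^t+j]≡3*2^t+j (suc t) (suc (2 * j)) 1+2j<2^[1+t] ⟩
  3 * 2 ^ suc t + suc (2 * j)    ≡⟨ double+1 (2 ^ t) j ⟩
  suc (2 * (3 * 2 ^ t + j))      ≡⟨ cong (suc ∘ (2 *_)) (x[2^t+j]≡3*2^t+j t j j<2^t) ⟨
  suc (2 * x (2 ^ t + j))        ∎
  where
  open ≡-Reasoning
  double+1 : ∀ P j → 3 * (2 * P) + suc (2 * j) ≡ suc (2 * (3 * P + j))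
  double+1 = solve-∀
  1+2j<2^[1+t] : suc (2 * j) < 2 ^ suc t
  1+2j<2^[1+t] = ≤-trans (≤-reflexive (sym (*-suc 2 j))) (*-monoʳ-≤ 2 j<2^t)

theorem4 : (x 1 ≡ 3) × (x 2 ≡ 6)
         × ((n : ℕ) → 2 ≤ n → x (2 * n ∸ 1) ≡ 2 * x (n ∸ 1) + 1)
         × ((n : ℕ) → 1 ≤ n → x (2 * n) ≡ 2 * x n)
theorem4 = refl , refl , odd-indices , x[2n]≡2*xn
  where
  odd-indices : (n : ℕ) → 2 ≤ n → x (2 * n ∸ 1) ≡ 2 * x (n ∸ 1) + 1
  odd-indices (suc m) (s≤s 0<m) = begin
    x (2 * suc m ∸ 1)   ≡⟨ cong x (+-suc m (m + 0)) ⟩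
    x (suc (2 * m))     ≡⟨ x[1+2n]≡1+2*xn m 0<m ⟩
    suc (2 * x m)       ≡⟨ +-comm 1 (2 * x m) ⟩
    2 * x m + 1         ∎
    where open ≡-Reasoning
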